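{- For every positive integer $n$ and every $N$, every ordered graph $G^<$ on $N$ vertices that is covered by $n-1$ pairwise disjoint routes does not contain $NM^<_n$ as an ordered subgraph.
   Context: An ordered graph on $N$ vertices is a graph with vertex set $[N]$ ordered by the usual order of integers. Its matrix representation is the $N\times N$ $\{0,1\}$-matrix $A$ whose entry at $(i,j)$ is $1$ iff $i<j$ and $\{i,j\}$ is an edge. For $k\in\mathbb{N}$, a $k$th route in an $N\times N$ matrix is a set of positions $\{(i_\ell,j_\ell): \ell\in[2N-4k+3]\}$ with $(i_1,j_1)=(k,k)$, $(i_{2N-4k+3},j_{2N-4k+3})=(N-k+1,N-k+1)$, and for each $\ell\in[2N-4k+2]$ either ($i_{\ell+1}=i_\ell+1$ and $j_{\ell+1}=j_\ell$) or ($i_{\ell+1}=i_\ell$ and $j_{\ell+1}=j_\ell+1$). An ordered graph is covered by a set $R$ of routes if every position $(i,j)$ with $i<j$ and $\{i,j\}$ an edge lies in some route of $R$. An ordered graph $G^<$ on $[n]$ is an ordered subgraph of $H^<$ on $[N]$ if there is an increasing map $\phi:[n]\to[N]$ sending edges to edges. $NM^<_n$ is the ordered graph on $[2n]$ with edges $\{i,2n-i+1\}$, $i\in[n]$. -}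

module Defs where

open import Level using (0ℓ)
open import Data.Nat using (ℕ; zero; suc; _+_; _*_; _∸_; _≤_; _<_)
open import Data.Fin using (Fin)
open import Data.Product using (Σ; ∃; _×_; _,_)
open import Data.Sum using (_⊎_)
open import Relation.Nullary using (¬_)
open import Relation.Binary.PropositionalEquality using (_≡_; _≢_)

record OrderedGraph (N : ℕ) : Set₁ where
  field
    E      : ℕ → ℕ → Set
    E-sym    : ∀ {i j} → E i j → E j i
    E-irrefl : ∀ {i} → ¬ E i i
    E-inV    : ∀ {i j} → E i j → (1 ≤ i × i ≤ N) × (1 ≤ j × j ≤ N)
open OrderedGraph public

-- Matrix representation: entry (i,j) is 1 iff i < j and {i,j} is an edge.
MatrixOne : ∀ {N} → OrderedGraph N → ℕ → ℕ → Set
MatrixOne G i j = i < j × E G i j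

-- A k-th route in an N×N matrix: positions (i_ℓ, j_ℓ), ℓ ∈ [L] with
-- L = 2N - 4k + 3 (stated without truncated subtraction as L + 4k = 2N + 3),
-- starting at (k,k), ending at (N-k+1, N-k+1), each step going one down
-- (i+1) or one right (j+1).  Positions are 1-indexed, so k ≥ 1.
record Route (N k : ℕ) : Set where
  field
    k≥1   : 1 ≤ k
    len   : ℕ
    len≡  : len + 4 * k ≡ 2 * N + 3
    pos   : ℕ → ℕ × ℕ      -- only the values at ℓ ∈ [1, len] matter
    start : pos 1 ≡ (k , k)
    end   : ∀ m → m + k ≡ N + 1 → pos len ≡ (m , m)
    step  : ∀ ℓ → 1 ≤ ℓ → ℓ < len →
            (Σ ℕ λ i → Σ ℕ λ j → pos ℓ ≡ (i , j) ×
              (pos (suc ℓ) ≡ (suc i , j) ⊎ pos (suc ℓ) ≡ (i , suc j)))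
open Route public

_∈R_ : ∀ {N k} → ℕ × ℕ → Route N k → Set
p ∈R r = Σ ℕ λ ℓ → (1 ≤ ℓ × ℓ ≤ len r) × pos r ℓ ≡ p

AnyRoute : ℕ → Set
AnyRoute N = Σ ℕ λ k → Route N k

_∈AR_ : ∀ {N} → ℕ × ℕ → AnyRoute N → Set
p ∈AR (k , r) = p ∈R r

PairwiseDisjoint : ∀ {N m} → (Fin m → AnyRoute N) → Set
PairwiseDisjoint {N} {m} R =
  ∀ (s t : Fin m) → s ≢ t → ∀ (p : ℕ × ℕ) → p ∈AR R s → ¬ (p ∈AR R t)

CoveredBy : ∀ {N m} → OrderedGraph N → (Fin m → AnyRoute N) → Set
CoveredBy G R = ∀ i j → MatrixOne G i j → Σ (Fin _) λ t → (i , j) ∈AR R t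

OrderedSubgraph : ∀ {n N} → OrderedGraph n → OrderedGraph N → Set
OrderedSubgraph {n} {N} G H =
  Σ (ℕ → ℕ) λ φ →
    (∀ i → 1 ≤ i → i ≤ n → 1 ≤ φ i × φ i ≤ N) ×
    (∀ i j → 1 ≤ i → i < j → j ≤ n → φ i < φ j) ×
    (∀ i j → E G i j → E H (φ i) (φ j))

NMEdge : ℕ → ℕ → ℕ → Set
NMEdge n a b = Σ ℕ λ i → (1 ≤ i × i ≤ n) ×
  ((a ≡ i × b + i ≡ 2 * n + 1) ⊎ (b ≡ i × a + i ≡ 2 * n + 1))

private
  open import Data.Empty using (⊥; ⊥-elim)
  open import Data.Nat using (s≤s; z≤n)
  open import Data.Nat.Properties
  open import Data.Sum using (inj₁; inj₂)
  open import Relation.Binary.PropositionalEquality using (refl; sym; trans; cong; subst)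

  ii<2n+1 : ∀ n i → i ≤ n → i + i < 2 * n + 1
  ii<2n+1 n i i≤n = ≤-<-trans (+-mono-≤ i≤n (≤-trans i≤n (≤-reflexive (sym (+-identityʳ n)))))
                                 (m<m+n (2 * n) (s≤s z≤n))

  nm-irr : ∀ n i a → i ≤ n → a ≡ i → a + i ≡ 2 * n + 1 → ⊥
  nm-irr n i .i i≤n refl eq = <⇒≢ (ii<2n+1 n i i≤n) eq

  other-lo : ∀ n i b → i ≤ n → b + i ≡ 2 * n + 1 → 1 ≤ b
  other-lo n i zero i≤n eq = ⊥-elim (<⇒≢ lt eq)
    where lt : i < 2 * n + 1
          lt = ≤-<-trans (≤-trans i≤n (m≤m+n n (n + 0))) (m<m+n (2 * n) (s≤s z≤n))
  other-lo n i (suc b) i≤n eq = s≤s z≤n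

  other-hi : ∀ n i b → 1 ≤ i → b + i ≡ 2 * n + 1 → b ≤ 2 * n
  other-hi n i b 1≤i eq =
    +-cancelʳ-≤ 1 b (2 * n) (≤-trans (+-monoʳ-≤ b 1≤i) (≤-reflexive eq))

  i≤2n : ∀ n i → i ≤ n → i ≤ 2 * n
  i≤2n n i i≤n = ≤-trans i≤n (m≤m+n n (n + 0))

NM : (n : ℕ) → OrderedGraph (2 * n)
NM n = record
  { E      = NMEdge n
  ; E-sym    = λ { (i , r , inj₁ (p , q)) → i , r , inj₂ (p , q)
               ; (i , r , inj₂ (p , q)) → i , r , inj₁ (p , q) }
  ; E-irrefl = λ { (i , (_ , i≤n) , inj₁ (p , q)) → nm-irr n i _ i≤n p q
               ; (i , (_ , i≤n) , inj₂ (p , q)) → nm-irr n i _ i≤n p q }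
  ; E-inV    = λ { (i , (1≤i , i≤n) , inj₁ (refl , q)) →
                    (1≤i , i≤2n n i i≤n) , (other-lo n i _ i≤n q , other-hi n i _ 1≤i q)
               ; (i , (1≤i , i≤n) , inj₂ (refl , q)) →
                    (other-lo n i _ i≤n q , other-hi n i _ 1≤i q) , (1≤i , i≤2n n i i≤n) }
  }

-- A route moves only down and right, so its positions are totally ordered
-- componentwise: no route contains two positions (a₁ , b₁), (a₂ , b₂) with
-- a₁ < a₂ and b₂ < b₁.  The n edges {i, 2n+1−i} of NM_n are nested, so an
-- embedding φ sends them to n matrix positions, any two of which are in this
-- "inverted" relation.  By pigeonhole, n − 1 routes cannot cover them all.
module Submission where

open import Defs
open import Data.Nat using (ℕ; zero; suc; _+_; _*_; _∸_; _≤_; _<_; s≤s; z≤n)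
open import Data.Nat.Properties
open import Data.Fin using (Fin; toℕ)
open import Data.Fin.Properties using (pigeonhole; toℕ<n)
open import Data.Product using (Σ; _×_; _,_; proj₁; proj₂)
open import Data.Sum using (_⊎_; inj₁; inj₂)
open import Data.Empty using (⊥)
open import Relation.Nullary using (¬_)
open import Relation.Binary.PropositionalEquality

infix 4 _≼_

_≼_ : ℕ × ℕ → ℕ × ℕ → Set
(a₁ , b₁) ≼ (a₂ , b₂) = a₁ ≤ a₂ × b₁ ≤ b₂

≼-refl : ∀ {p} → p ≼ p
≼-refl = ≤-refl , ≤-refl

≼-trans : ∀ {p q r} → p ≼ q → q ≼ r → p ≼ r
≼-trans (a , b) (c , d) = ≤-trans a c , ≤-trans b d

Inverted : ℕ × ℕ → ℕ × ℕ → Set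
Inverted (a₁ , b₁) (a₂ , b₂) = a₁ < a₂ × b₂ < b₁

Inverted⇒⋠ : ∀ {p q} → Inverted p q → ¬ (p ≼ q)
Inverted⇒⋠ (_ , b₂<b₁) (_ , b₁≤b₂) = <⇒≱ b₂<b₁ b₁≤b₂

Inverted⇒⋡ : ∀ {p q} → Inverted p q → ¬ (q ≼ p)
Inverted⇒⋡ (a₁<a₂ , _) (a₂≤a₁ , _) = <⇒≱ a₁<a₂ a₂≤a₁

module _ {N k : ℕ} (r : Route N k) where

  pos-step-≼ : ∀ ℓ → 1 ≤ ℓ → ℓ < len r → pos r ℓ ≼ pos r (suc ℓ)
  pos-step-≼ ℓ 1≤ℓ ℓ<len with step r ℓ 1≤ℓ ℓ<len
  ... | i , j , eq , inj₁ eq′ rewrite eq | eq′ = n≤1+n i , ≤-refl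
  ... | i , j , eq , inj₂ eq′ rewrite eq | eq′ = ≤-refl , n≤1+n j

  pos-mono : ∀ {ℓ₁ ℓ₂} → 1 ≤ ℓ₁ → ℓ₁ ≤ ℓ₂ → ℓ₂ ≤ len r → pos r ℓ₁ ≼ pos r ℓ₂
  pos-mono {ℓ₂ = zero} () z≤n _
  pos-mono {ℓ₂ = suc ℓ} 1≤ℓ₁ ℓ₁≤1+ℓ 1+ℓ≤len with m≤n⇒m<n∨m≡n ℓ₁≤1+ℓ
  ... | inj₂ refl = ≼-refl
  ... | inj₁ (s≤s ℓ₁≤ℓ) =
    ≼-trans (pos-mono 1≤ℓ₁ ℓ₁≤ℓ (<⇒≤ 1+ℓ≤len))
            (pos-step-≼ ℓ (≤-trans 1≤ℓ₁ ℓ₁≤ℓ) 1+ℓ≤len)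

  ∈R-comparable : ∀ {p q} → p ∈R r → q ∈R r → p ≼ q ⊎ q ≼ p
  ∈R-comparable (ℓ₁ , (1≤ℓ₁ , ℓ₁≤len) , refl) (ℓ₂ , (1≤ℓ₂ , ℓ₂≤len) , refl)
    with ≤-total ℓ₁ ℓ₂
  ... | inj₁ ℓ₁≤ℓ₂ = inj₁ (pos-mono 1≤ℓ₁ ℓ₁≤ℓ₂ ℓ₂≤len)
  ... | inj₂ ℓ₂≤ℓ₁ = inj₂ (pos-mono 1≤ℓ₂ ℓ₂≤ℓ₁ ℓ₁≤len)

∈AR-¬Inverted : ∀ {N} (r : AnyRoute N) {p q} →
                Inverted p q → p ∈AR r → q ∈AR r → ⊥
∈AR-¬Inverted (_ , r) p⋈q p∈r q∈r with ∈R-comparable r p∈r q∈r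
... | inj₁ p≼q = Inverted⇒⋠ p⋈q p≼q
... | inj₂ q≼p = Inverted⇒⋡ p⋈q q≼p

inverted-family-¬covered :
  ∀ {N m n} → m < n → (R : Fin m → AnyRoute N) (p : Fin n → ℕ × ℕ) →
  (∀ s t → toℕ s < toℕ t → Inverted (p s) (p t)) →
  ¬ (∀ t → Σ (Fin m) λ u → p t ∈AR R u)
inverted-family-¬covered m<n R p inverted cover
  with pigeonhole m<n (λ t → proj₁ (cover t))
... | s , t , s<t , same =
  ∈AR-¬Inverted (R (proj₁ (cover s))) (inverted s t s<t)
    (proj₂ (cover s))
    (subst (p t ∈AR_) (cong R (sym same)) (proj₂ (cover t)))

-- Vertex t + 1 of NM_n (0 ≤ t < n) is joined to partner n t = 2n − t.
partner : ℕ → ℕ → ℕ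
partner n t = n + (n ∸ t)

partner+1+t : ∀ n t → t < n → partner n t + suc t ≡ 2 * n + 1
partner+1+t n t t<n = begin
  n + (n ∸ t) + suc t       ≡⟨ +-suc (n + (n ∸ t)) t ⟩
  suc (n + (n ∸ t) + t)     ≡⟨ cong suc (+-assoc n (n ∸ t) t) ⟩
  suc (n + ((n ∸ t) + t))   ≡⟨ cong (λ z → suc (n + z)) (m∸n+n≡m (<⇒≤ t<n)) ⟩
  suc (n + n)               ≡⟨ cong (λ z → suc (n + z)) (sym (+-identityʳ n)) ⟩
  suc (2 * n)               ≡⟨ +-comm 1 (2 * n) ⟩
  2 * n + 1                 ∎
  where open ≡-Reasoning

1+t<partner : ∀ n t → t < n → suc t < partner n t
1+t<partner n t t<n =
  ≤-trans (s≤s t<n) (subst (_≤ partner n t) (+-comm n 1) (+-monoʳ-≤ n (m<n⇒0<n∸m t<n)))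

partner≤2n : ∀ n t → partner n t ≤ 2 * n
partner≤2n n t =
  subst (partner n t ≤_) (cong (n +_) (sym (+-identityʳ n))) (+-monoʳ-≤ n (m∸n≤m n t))

partner-anti : ∀ n {s t} → s < t → t < n → partner n t < partner n s
partner-anti n s<t t<n = +-monoʳ-< n (∸-monoʳ-< s<t (<⇒≤ t<n))

NM-edge : ∀ n t → t < n → E (NM n) (suc t) (partner n t)
NM-edge n t t<n = suc t , (s≤s z≤n , t<n) , inj₁ (refl , partner+1+t n t t<n)

lemma19 : (n : ℕ) → 1 ≤ n → (N : ℕ) → (G : OrderedGraph N) →
          (R : Fin (n ∸ 1) → AnyRoute N) →
          PairwiseDisjoint R → CoveredBy G R →
          ¬ OrderedSubgraph (NM n) G
lemma19 n@(suc m) _ N G R _ covered (φ , _ , φ-mono , φ-edge) =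
  inverted-family-¬covered ≤-refl R image image-inverted
    (λ t → covered _ _ (image-in-matrix t))
  where
    image : Fin n → ℕ × ℕ
    image t = φ (suc (toℕ t)) , φ (partner n (toℕ t))

    image-in-matrix : ∀ t → MatrixOne G (φ (suc (toℕ t))) (φ (partner n (toℕ t)))
    image-in-matrix t =
      φ-mono _ _ (s≤s z≤n) (1+t<partner n _ (toℕ<n t)) (partner≤2n n (toℕ t)) ,
      φ-edge _ _ (NM-edge n _ (toℕ<n t))

    image-inverted : ∀ s t → toℕ s < toℕ t → Inverted (image s) (image t)
    image-inverted s t s<t =
      φ-mono _ _ (s≤s z≤n) (s≤s s<t) (≤-trans (toℕ<n t) (m≤m+n n (n + 0))) ,
      φ-mono _ _ (s≤s z≤n) (partner-anti n s<t (toℕ<n t)) (partner≤2n n (toℕ s))
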